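{- Let $k\ge 2$. If $G$ is a graph admitting a closed neighborhood balanced $k$-coloring, then the direct product $G\times K_2$ admits a closed neighborhood balanced $k$-coloring.
   Context: All graphs are finite and simple. $N[v]$ is the closed neighborhood of $v$. A closed neighborhood balanced $k$-coloring of a graph is a map $c$ from its vertex set to $\{1,\dots,k\}$ such that for every vertex $v$ the numbers $|N[v]\cap c^{ -1}(i)|$, $i=1,\dots,k$, are all equal. The direct product $G\times H$ has vertex set $V(G)\times V(H)$, with $(g,h)$ and $(g',h')$ adjacent iff $gg'\in E(G)$ and $hh'\in E(H)$. -}

module Defs where

open import Data.Nat using (ℕ; _*_)
open import Data.Fin using (Fin; remQuot)
open import Data.Fin.Properties using (_≟_)
open import Data.List using (List; length; filter)
open import Data.List.Base using (allFin)
open import Data.Product using (Σ; _×_; _,_; proj₁; proj₂)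
open import Data.Sum using (_⊎_)
open import Data.Empty using (⊥)
open import Relation.Nullary using (Dec; ¬_; _×-dec_; _⊎-dec_)
open import Relation.Binary.PropositionalEquality using (_≡_)

record Graph : Set₁ where
  field
    n      : ℕ
    Adj    : Fin n → Fin n → Set
    adj?   : ∀ u v → Dec (Adj u v)
    sym    : ∀ {u v} → Adj u v → Adj v u
    irrefl : ∀ {u} → ¬ Adj u u

open Graph public

InClosedNbhd : (G : Graph) → Fin (n G) → Fin (n G) → Set
InClosedNbhd G v u = (u ≡ v) ⊎ Adj G v u

inClosedNbhd? : (G : Graph) → ∀ v u → Dec (InClosedNbhd G v u)
inClosedNbhd? G v u = (u ≟ v) ⊎-dec adj? G v u

nbhdColorCount : (G : Graph) {k : ℕ} → (Fin (n G) → Fin k) → Fin (n G) → Fin k → ℕ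
nbhdColorCount G c v i =
  length (filter (λ u → inClosedNbhd? G v u ×-dec (c u ≟ i)) (allFin (n G)))

IsCNBColoring : (G : Graph) (k : ℕ) → (Fin (n G) → Fin k) → Set
IsCNBColoring G k c = ∀ v (i j : Fin k) → nbhdColorCount G c v i ≡ nbhdColorCount G c v j

HasCNBColoring : Graph → ℕ → Set
HasCNBColoring G k = Σ (Fin (n G) → Fin k) (IsCNBColoring G k)

K : ℕ → Graph
K m = record
  { n = m
  ; Adj = λ u v → ¬ (u ≡ v)
  ; adj? = λ u v → Relation.Nullary.¬? (u ≟ v)
  ; sym = λ p q → p (Relation.Binary.PropositionalEquality.sym q)
  ; irrefl = λ p → p Relation.Binary.PropositionalEquality.refl
  }

-- Direct product G × H, vertex set Fin (n G * n H) identified with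
-- Fin (n G) × Fin (n H) via remQuot (a bijection, inverse of combine).
module _ (G H : Graph) where
  fstV : Fin (n G * n H) → Fin (n G)
  fstV x = proj₁ (remQuot {n G} (n H) x)

  sndV : Fin (n G * n H) → Fin (n H)
  sndV x = proj₂ (remQuot {n G} (n H) x)

  ProdAdj : Fin (n G * n H) → Fin (n G * n H) → Set
  ProdAdj x y = Adj G (fstV x) (fstV y) × Adj H (sndV x) (sndV y)

  _×ᴳ_ : Graph
  _×ᴳ_ = record
    { n = n G * n H
    ; Adj = ProdAdj
    ; adj? = λ x y → adj? G (fstV x) (fstV y) ×-dec adj? H (sndV x) (sndV y)
    ; sym = λ (p , q) → sym G p , sym H q
    ; irrefl = λ (p , q) → irrefl G p
    }

-- The lift c ∘ π₁ of a balanced colouring c of G is balanced on G × K₂.  Above a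
-- vertex g of G, the closed neighbourhood of (v , h) meets the fibre {g} × K₂ in
-- {(v , h)} if g = v, in {g} × N(h) if g ∈ N(v), and nowhere otherwise.  Since
-- K₂ is 1-regular, each fibre contributes one vertex of colour c g exactly when
-- g ∈ N[v], so colour counts around (v , h) in G × K₂ equal those around v in G.
-- The argument works for any 1-regular second factor.
module Submission where

open import Level using (Level)
open import Defs hiding (sym)
open import Data.Bool.Base using (Bool; if_then_else_)
open import Data.Empty using (⊥-elim)
open import Data.Fin.Base using (Fin; zero; suc; _↑ˡ_; _↑ʳ_; combine)
open import Data.Fin.Properties using (_≟_; remQuot-combine; combine-remQuot; combine-injective)
open import Data.List.Base using (length; filter; tabulate; allFin)
open import Data.Nat.Base using (ℕ; zero; suc; _+_; _*_; _≥_)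
open import Data.Nat.Properties using (+-0-monoid; +-assoc)
open import Data.Product.Base using (_×_; _,_; proj₁; proj₂)
open import Data.Product.Function.NonDependent.Propositional using (_×-⇔_)
open import Data.Sum.Base using (_⊎_; inj₁; inj₂)
open import Function.Base using (_∘_)
open import Function.Bundles using (_⇔_; mk⇔)
open import Relation.Nullary.Decidable using (Dec; yes; no; does; _×-dec_; _⊎-dec_; does-⇔)
open import Relation.Nullary.Negation using (¬_)
open import Relation.Unary using (Pred; Decidable)
open import Relation.Binary.PropositionalEquality
  using (_≡_; refl; sym; trans; cong; subst₂; module ≡-Reasoning)
open import Algebra.Properties.Monoid.Sum +-0-monoid
  using (sum-syntax; sum-cong-≗; sum-replicate-zero)

private
  variable
    ℓ₁ ℓ₂ ℓ₃ p q : Level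
    A : Set ℓ₁
    B : Set ℓ₂
    C : Set ℓ₃
    m k : ℕ

indicator : Bool → ℕ
indicator b = if b then 1 else 0

𝟙 : Dec A → ℕ
𝟙 = indicator ∘ does

count : {P : Pred (Fin m) p} → Decidable P → ℕ
count {m = m} P? = length (filter P? (allFin m))

∑-↑ : ∀ m {n} (f : Fin (m + n) → ℕ) →
      ∑[ x < m + n ] f x ≡ ∑[ i < m ] f (i ↑ˡ n) + ∑[ j < n ] f (m ↑ʳ j)
∑-↑ zero    f = refl
∑-↑ (suc m) f = trans (cong (f zero +_) (∑-↑ m (f ∘ suc))) (sym (+-assoc (f zero) _ _))

∑-combine : ∀ m k (f : Fin (m * k) → ℕ) →
            ∑[ x < m * k ] f x ≡ ∑[ i < m ] ∑[ j < k ] f (combine i j)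
∑-combine zero    k f = refl
∑-combine (suc m) k f =
  trans (∑-↑ k f) (cong (∑[ j < k ] f (j ↑ˡ (m * k)) +_) (∑-combine m k (f ∘ (k ↑ʳ_))))

module _ {P : Pred A p} (P? : Decidable P) where

  length-filter-tabulate : (f : Fin m → A) → length (filter P? (tabulate f)) ≡ ∑[ i < m ] 𝟙 (P? (f i))
  length-filter-tabulate {zero}  f = refl
  length-filter-tabulate {suc m} f with P? (f zero)
  ... | yes _ = cong suc (length-filter-tabulate (f ∘ suc))
  ... | no  _ = length-filter-tabulate (f ∘ suc)

count≡∑𝟙 : {P : Pred (Fin m) p} (P? : Decidable P) → count P? ≡ ∑[ x < m ] 𝟙 (P? x)
count≡∑𝟙 P? = length-filter-tabulate P? (λ x → x)

count-cong : {P : Pred (Fin m) p} {Q : Pred (Fin m) q} (P? : Decidable P) (Q? : Decidable Q) →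
             (∀ x → P x ⇔ Q x) → count P? ≡ count Q?
count-cong {m = m} P? Q? P⇔Q = begin
  count P?                 ≡⟨ count≡∑𝟙 P? ⟩
  ∑[ x < m ] 𝟙 (P? x)      ≡⟨ sum-cong-≗ (λ x → cong indicator (does-⇔ (P⇔Q x) (P? x) (Q? x))) ⟩
  ∑[ x < m ] 𝟙 (Q? x)      ≡⟨ count≡∑𝟙 Q? ⟨
  count Q?                 ∎
  where open ≡-Reasoning

count-empty : {P : Pred (Fin m) p} (P? : Decidable P) → (∀ x → ¬ P x) → count P? ≡ 0
count-empty {m = m} P? ¬P = begin
  count P?              ≡⟨ count≡∑𝟙 P? ⟩
  ∑[ x < m ] 𝟙 (P? x)   ≡⟨ sum-cong-≗ 𝟙P≡0 ⟩
  ∑[ x < m ] 0          ≡⟨ sum-replicate-zero m ⟩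
  0                     ∎
  where
  open ≡-Reasoning
  𝟙P≡0 : ∀ x → 𝟙 (P? x) ≡ 0
  𝟙P≡0 x with P? x
  ... | yes px = ⊥-elim (¬P x px)
  ... | no  _  = refl

∑𝟙-≟ : (h : Fin m) → ∑[ j < m ] 𝟙 (j ≟ h) ≡ 1
∑𝟙-≟ {suc m} zero    = cong suc (sum-replicate-zero m)
∑𝟙-≟ {suc m} (suc h) = ∑𝟙-≟ h

count-≡ : (h : Fin m) → count (_≟ h) ≡ 1
count-≡ h = trans (count≡∑𝟙 (_≟ h)) (∑𝟙-≟ h)

count-combine : {P : Pred (Fin (m * k)) p} (P? : Decidable P) →
                count P? ≡ ∑[ i < m ] count (P? ∘ combine i)
count-combine {m = m} {k = k} P? = begin
  count P?                                  ≡⟨ count≡∑𝟙 P? ⟩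
  ∑[ x < m * k ] 𝟙 (P? x)                   ≡⟨ ∑-combine m k (𝟙 ∘ P?) ⟩
  ∑[ i < m ] ∑[ j < k ] 𝟙 (P? (combine i j)) ≡⟨ sum-cong-≗ (λ i → count≡∑𝟙 (P? ∘ combine {m} {k} i)) ⟨
  ∑[ i < m ] count (P? ∘ combine i)         ∎
  where open ≡-Reasoning

module _ {P : Pred (Fin m) p} {Q : Pred (Fin m) q} (P? : Decidable P) (Q? : Decidable Q) where

  guarded-⊎? : Dec A → Dec B → Dec C → Decidable (λ j → (A × P j ⊎ B × Q j) × C)
  guarded-⊎? A? B? C? j = ((A? ×-dec P? j) ⊎-dec (B? ×-dec Q? j)) ×-dec C?

  count-guarded-⊎ : count P? ≡ 1 → count Q? ≡ 1 →
                    (A? : Dec A) (B? : Dec B) (C? : Dec C) → (A → ¬ B) →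
                    count (guarded-⊎? A? B? C?) ≡ 𝟙 ((A? ⊎-dec B?) ×-dec C?)
  count-guarded-⊎ #P≡1 _ (yes a) B? (yes c) A⇒¬B =
    trans (count-cong (guarded-⊎? (yes a) B? (yes c)) P? (λ _ → mk⇔ only-P (λ p → inj₁ (a , p) , c))) #P≡1
    where
    only-P : ∀ {j} → (_ × P j ⊎ _ × Q j) × _ → P j
    only-P (inj₁ (_ , p) , _) = p
    only-P (inj₂ (b , _) , _) = ⊥-elim (A⇒¬B a b)
  count-guarded-⊎ _ #Q≡1 (no ¬a) (yes b) (yes c) _ =
    trans (count-cong (guarded-⊎? (no ¬a) (yes b) (yes c)) Q? (λ _ → mk⇔ only-Q (λ q → inj₂ (b , q) , c))) #Q≡1
    where
    only-Q : ∀ {j} → (_ × P j ⊎ _ × Q j) × _ → Q j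
    only-Q (inj₁ (a , _) , _) = ⊥-elim (¬a a)
    only-Q (inj₂ (_ , q) , _) = q
  count-guarded-⊎ _ _ (no ¬a) (no ¬b) C? _ = count-empty (guarded-⊎? (no ¬a) (no ¬b) C?) λ
    { _ (inj₁ (a , _) , _) → ¬a a
    ; _ (inj₂ (b , _) , _) → ¬b b }
  count-guarded-⊎ _ _ (yes a) B? (no ¬c) _ = count-empty (guarded-⊎? (yes a) B? (no ¬c)) λ _ → ¬c ∘ proj₂
  count-guarded-⊎ _ _ (no ¬a) (yes b) (no ¬c) _ = count-empty (guarded-⊎? (no ¬a) (yes b) (no ¬c)) λ _ → ¬c ∘ proj₂

nbhdColor? : (G : Graph) (c : Fin (n G) → Fin k) (v : Fin (n G)) (i : Fin k) →
             Decidable (λ u → InClosedNbhd G v u × c u ≡ i)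
nbhdColor? G c v i u = inClosedNbhd? G v u ×-dec (c u ≟ i)

degree : (H : Graph) → Fin (n H) → ℕ
degree H h = count (adj? H h)

IsRegular : Graph → ℕ → Set
IsRegular H r = ∀ h → degree H h ≡ r

K₂-isRegular₁ : IsRegular (K 2) 1
K₂-isRegular₁ zero       = refl
K₂-isRegular₁ (suc zero) = refl

module _ (G H : Graph) where

  pairV : Fin (n G) → Fin (n H) → Fin (n G * n H)
  pairV = combine

  fstV-pairV : ∀ g h → fstV G H (pairV g h) ≡ g
  fstV-pairV g h = cong proj₁ (remQuot-combine g h)

  sndV-pairV : ∀ g h → sndV G H (pairV g h) ≡ h
  sndV-pairV g h = cong proj₂ (remQuot-combine g h)

  closedNbhd-×ᴳ : ∀ v h g j → InClosedNbhd (G ×ᴳ H) (pairV v h) (pairV g j)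
                              ⇔ ((g ≡ v × j ≡ h) ⊎ (Adj G v g × Adj H h j))
  closedNbhd-×ᴳ v h g j = mk⇔ to from
    where
    to : InClosedNbhd (G ×ᴳ H) (pairV v h) (pairV g j) → (g ≡ v × j ≡ h) ⊎ (Adj G v g × Adj H h j)
    to (inj₁ gj≡vh)   = inj₁ (combine-injective g j v h gj≡vh)
    to (inj₂ (a , b)) = inj₂ ( subst₂ (Adj G) (fstV-pairV v h) (fstV-pairV g j) a
                             , subst₂ (Adj H) (sndV-pairV v h) (sndV-pairV g j) b )
    from : (g ≡ v × j ≡ h) ⊎ (Adj G v g × Adj H h j) → InClosedNbhd (G ×ᴳ H) (pairV v h) (pairV g j)
    from (inj₁ (refl , refl)) = inj₁ refl
    from (inj₂ (a , b))       = inj₂ ( subst₂ (Adj G) (sym (fstV-pairV v h)) (sym (fstV-pairV g j)) a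
                                     , subst₂ (Adj H) (sym (sndV-pairV v h)) (sym (sndV-pairV g j)) b )

  module _ (H-isRegular₁ : IsRegular H 1) {k} (c : Fin (n G) → Fin k) where

    nbhdColorCount-fibre : ∀ v h i g →
      count (nbhdColor? (G ×ᴳ H) (c ∘ fstV G H) (pairV v h) i ∘ pairV g) ≡ 𝟙 (nbhdColor? G c v i g)
    nbhdColorCount-fibre v h i g = trans
      (count-cong _ (guarded-⊎? (_≟ h) (adj? H h) (g ≟ v) (adj? G v g) (c g ≟ i))
                  (λ j → closedNbhd-×ᴳ v h g j ×-⇔ colour-⇔ j))
      (count-guarded-⊎ (_≟ h) (adj? H h) (count-≡ h) (H-isRegular₁ h) (g ≟ v) (adj? G v g) (c g ≟ i)
                       (λ { refl → irrefl G }))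
      where
      colour-⇔ : ∀ j → (c (fstV G H (pairV g j)) ≡ i) ⇔ (c g ≡ i)
      colour-⇔ j = mk⇔ (trans (cong c (sym (fstV-pairV g j)))) (trans (cong c (fstV-pairV g j)))

    nbhdColorCount-lift : ∀ x i → nbhdColorCount (G ×ᴳ H) (c ∘ fstV G H) x i ≡ nbhdColorCount G c (fstV G H x) i
    nbhdColorCount-lift x i = begin
      nbhdColorCount (G ×ᴳ H) (c ∘ fstV G H) x i
        ≡⟨ cong (λ y → nbhdColorCount (G ×ᴳ H) (c ∘ fstV G H) y i) (combine-remQuot {n G} (n H) x) ⟨
      count (nbhdColor? (G ×ᴳ H) (c ∘ fstV G H) (pairV v h) i)
        ≡⟨ count-combine {m = n G} (nbhdColor? (G ×ᴳ H) (c ∘ fstV G H) (pairV v h) i) ⟩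
      ∑[ g < n G ] count (nbhdColor? (G ×ᴳ H) (c ∘ fstV G H) (pairV v h) i ∘ pairV g)
        ≡⟨ sum-cong-≗ (nbhdColorCount-fibre v h i) ⟩
      ∑[ g < n G ] 𝟙 (nbhdColor? G c v i g)
        ≡⟨ count≡∑𝟙 (nbhdColor? G c v i) ⟨
      nbhdColorCount G c v i
        ∎
      where
      open ≡-Reasoning
      v = fstV G H x
      h = sndV G H x

    isCNBColoring-lift : IsCNBColoring G k c → IsCNBColoring (G ×ᴳ H) k (c ∘ fstV G H)
    isCNBColoring-lift balanced x i j = begin
      nbhdColorCount (G ×ᴳ H) (c ∘ fstV G H) x i ≡⟨ nbhdColorCount-lift x i ⟩
      nbhdColorCount G c (fstV G H x) i          ≡⟨ balanced (fstV G H x) i j ⟩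
      nbhdColorCount G c (fstV G H x) j          ≡⟨ nbhdColorCount-lift x j ⟨
      nbhdColorCount (G ×ᴳ H) (c ∘ fstV G H) x j ∎
      where open ≡-Reasoning

theorem2p26 : (k : ℕ) → k ≥ 2 → (G : Graph) → HasCNBColoring G k → HasCNBColoring (G ×ᴳ K 2) k
theorem2p26 k _ G (c , balanced) = c ∘ fstV G (K 2) , isCNBColoring-lift G (K 2) K₂-isRegular₁ c balanced
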